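{- Let $k$ be a number field, $m\geq n\geq1$, $0\leq r\leq n-1$, $h\in\mathrm{GL}_m(k)$, $g\in\mathrm{GL}_n(k)$, and let $$\underline{v}=(0_n,\dots,0_n,e_n^T,e_{n-1}^T,\dots,e_{n-r}^T)\in k^{mn},$$ where $0_n$ is the zero row vector of length $n$, appearing $m-r-1$ times. Then there exists $\lambda\in k^\times$ with $\underline{v}\,t(h,g)=\lambda\underline{v}$ if and only if $t(h,g)\in t_\Delta\big(P^m_{r+1}(k),P^n_{r+1}(k)\big)$.
   Context: $e_1,\dots,e_n$ is the standard column basis of $k^n$. $t(h,g)$ is the Kronecker product of $h=(h_{ij})$ and $g$: the $mn\times mn$ block matrix with $(i,j)$ block $h_{ij}g$; $T_{m,n}(k)$ is its image. Let $\tilde w$ be the $(r+1)\times(r+1)$ antidiagonal matrix with antidiagonal entries $1$, and for $d\in\mathrm{GL}_{r+1}(k)$ set $d^\ast=\tilde w^{ -1}(d^T)^{ -1}\tilde w$. $t_\Delta(P^m_{r+1}(k),P^n_{r+1}(k))$ is the set of all $t\left(\begin{pmatrix}A&B\\0&\lambda d^\ast\end{pmatrix},\begin{pmatrix}a&b\\0&d\end{pmatrix}\right)\in T_{m,n}(k)$ with $A\in\mathrm{GL}_{m-r-1}(k)$, $a\in\mathrm{GL}_{n-r-1}(k)$, $d\in\mathrm{GL}_{r+1}(k)$, $\lambda\in k^\times$, and $B,b$ arbitrary of appropriate sizes. -}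

module Defs where

open import Level using (_⊔_)
open import Data.Nat using (ℕ; zero; suc) renaming (_+_ to _ℕ+_)
open import Data.Integer using (ℤ; +_; -[1+_])
open import Data.Fin using (Fin; zero; suc; splitAt; opposite; _↑ʳ_; _≟_)
open import Data.Sum using (inj₁; inj₂)
open import Data.Product using (Σ; ∃; _×_)
open import Relation.Nullary using (¬_; yes; no)
open import Algebra.Bundles using (CommutativeRing)

module LinAlg {c ℓ} (K : CommutativeRing c ℓ) where
  open CommutativeRing K public using (Carrier; _≈_; _+_; _*_; -_; 0#; 1#)

  Σ[_] : ∀ n → (Fin n → Carrier) → Carrier
  Σ[ zero ] f = 0#
  Σ[ suc n ] f = f zero + Σ[ n ] (λ i → f (suc i))

  ℕ→K : ℕ → Carrier
  ℕ→K zero = 0#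
  ℕ→K (suc n) = 1# + ℕ→K n

  ℤ→K : ℤ → Carrier
  ℤ→K (+ n) = ℕ→K n
  ℤ→K -[1+ n ] = - ℕ→K (suc n)

  Mat : ℕ → ℕ → Set c
  Mat m n = Fin m → Fin n → Carrier

  _≈M_ : ∀ {m n} → Mat m n → Mat m n → Set ℓ
  A ≈M B = ∀ i j → A i j ≈ B i j

  _*M_ : ∀ {m n p} → Mat m n → Mat n p → Mat m p
  _*M_ {n = n} A B i j = Σ[ n ] (λ k → A i k * B k j)

  _·M_ : ∀ {m n} → Carrier → Mat m n → Mat m n
  (x ·M A) i j = x * A i j

  transpose : ∀ {m n} → Mat m n → Mat n m
  transpose A i j = A j i

  δ : ∀ {n} → Fin n → Fin n → Carrier
  δ i j with i ≟ j
  ... | yes _ = 1#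
  ... | no _ = 0#

  I : ∀ n → Mat n n
  I n = δ

  IsInverse : ∀ {n} → Mat n n → Mat n n → Set ℓ
  IsInverse {n} A B = ((A *M B) ≈M I n) × ((B *M A) ≈M I n)

  GL : ∀ {n} → Mat n n → Set (c ⊔ ℓ)
  GL {n} A = ∃ λ B → IsInverse A B

  w̃ : ∀ n → Mat n n
  w̃ n i j = δ (opposite i) j

  -- d* = w̃⁻¹ (dᵀ)⁻¹ w̃, given witnesses e = (dᵀ)⁻¹ and winv = w̃⁻¹
  star : ∀ {n} → (d e winv : Mat n n) → Mat n n
  star {n} d e winv = (winv *M e) *M w̃ n

  upperBlock : ∀ {p q} → Mat p p → Mat p q → Mat q q → Mat (p ℕ+ q) (p ℕ+ q)
  upperBlock {p} A B D i j with splitAt p i | splitAt p j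
  ... | inj₁ i′ | inj₁ j′ = A i′ j′
  ... | inj₁ i′ | inj₂ j′ = B i′ j′
  ... | inj₂ i′ | inj₁ j′ = 0#
  ... | inj₂ i′ | inj₂ j′ = D i′ j′

  -- Kronecker product t(h,g): the mn×mn matrix whose (i,j) block is h_ij g;
  -- rows/columns of k^{mn} are indexed by (block index, index within block).
  t : ∀ {m n} → Mat m m → Mat n n → (Fin m × Fin n) → (Fin m × Fin n) → Carrier
  t h g (i Data.Product., a) (j Data.Product., b) = h i j * g a b

  _≈T_ : ∀ {m n} → (X Y : (Fin m × Fin n) → (Fin m × Fin n) → Carrier) → Set ℓ
  X ≈T Y = ∀ x y → X x y ≈ Y x y

  _·T_ : ∀ {m n} → ((Fin m × Fin n) → Carrier)
       → ((Fin m × Fin n) → (Fin m × Fin n) → Carrier) → (Fin m × Fin n) → Carrier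
  _·T_ {m} {n} v X (j Data.Product., b) =
    Σ[ m ] (λ i → Σ[ n ] (λ a → v (i Data.Product., a) * X (i Data.Product., a) (j Data.Product., b)))

  e : ∀ {n} → Fin n → Fin n → Carrier
  e j a = δ j a

  -- v = (0_n,…,0_n, e_n^T, e_{n-1}^T, …, e_{n-r}^T) ∈ K^{mn}, with m = p + (r+1),
  -- n = q + (r+1): the first p blocks are zero, and block p+s (s = 0..r) is
  -- e_{n-s}^T, i.e. the basis vector with 0-based index n-1-s = q + (r - s).
  vvec : ∀ p q r → (Fin (p ℕ+ suc r) × Fin (q ℕ+ suc r)) → Carrier
  vvec p q r (i Data.Product., a) with splitAt p i
  ... | inj₁ _ = 0#
  ... | inj₂ s = e (q ↑ʳ opposite s) a

  -- t(h,g) ∈ t_Δ(P^m_{r+1}(K), P^n_{r+1}(K)) with m = p + (r+1), n = q + (r+1)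
  InTΔ : ∀ p q r → Mat (p ℕ+ suc r) (p ℕ+ suc r) → Mat (q ℕ+ suc r) (q ℕ+ suc r) → Set (c ⊔ ℓ)
  InTΔ p q r h g =
    Σ (Mat p p) λ A → Σ (Mat p (suc r)) λ B → Σ (Mat q q) λ a → Σ (Mat q (suc r)) λ b →
    Σ (Mat (suc r) (suc r)) λ d → Σ Carrier λ lam →
    Σ (Mat (suc r) (suc r)) λ dTinv → Σ (Mat (suc r) (suc r)) λ winv →
      GL A × GL a × GL d × (¬ (lam ≈ 0#)) ×
      IsInverse (transpose d) dTinv × IsInverse (w̃ (suc r)) winv ×
      (t h g ≈T t (upperBlock A B (lam ·M star d dTinv winv)) (upperBlock a b d))

IsField : ∀ {c ℓ} → CommutativeRing c ℓ → Set (c ⊔ ℓ)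
IsField K = ¬ (1# ≈ 0#) × (∀ x → ¬ (x ≈ 0#) → ∃ λ y → (x * y) ≈ 1#)
  where open CommutativeRing K using (Carrier; _≈_; _+_; _*_; -_; 0#; 1#)

-- A number field: a field of characteristic 0 (so containing ℚ) which is a
-- finite-dimensional ℚ-vector space, i.e. spanned over ℚ by finitely many
-- elements b_1..b_d: every x is Σ (a_i/(N+1)) b_i with a_i ∈ ℤ, N ∈ ℕ.
IsNumberField : ∀ {c ℓ} → CommutativeRing c ℓ → Set (c ⊔ ℓ)
IsNumberField K =
  IsField K ×
  (∀ n → ¬ (ℕ→K (suc n) ≈ 0#)) ×
  (∃ λ d → Σ (Fin d → Carrier) λ bs →
     ∀ x → ∃ λ N → Σ (Fin d → ℤ) λ as →
       (ℕ→K (suc N) * x) ≈ Σ[ d ] (λ i → ℤ→K (as i) * bs i))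
  where open LinAlg K

-- Read v ∈ K^{mn} as the m×n matrix V whose only nonzero block is w̃, in the
-- lower right corner. Then v·t(h,g) = hᵀ V g only involves the last r+1 rows
-- of h and of g. If v·t(h,g) = λv, cancelling the invertible h and g shows that
-- these rows vanish outside the last r+1 columns, so h and g are block upper
-- triangular, and the corner entries say Dᵀ w̃ d = λ w̃ for the lower right
-- blocks D of h and d of g, which is D = λ d*. This relation makes D and d
-- invertible, hence also the upper left blocks. Conversely, block upper
-- triangularity together with D = λ d* gives back hᵀ V g = λ V.
module Submission where

open import Defs
open import Data.Nat using (ℕ; zero; suc; _≤_) renaming (_+_ to _ℕ+_)
open import Data.Fin using (Fin; zero; suc; splitAt; opposite; _↑ʳ_; _↑ˡ_; _≟_)
open import Data.Fin.Properties
  using (splitAt-↑ˡ; splitAt-↑ʳ; splitAt⁻¹-↑ˡ; splitAt⁻¹-↑ʳ; opposite-involutive;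
         ↑ʳ-injective; ↑ˡ-injective; suc-injective)
open import Data.Sum using (inj₁; inj₂)
open import Data.Product using (∃; _×_; _,_; proj₁; proj₂)
open import Data.Empty using (⊥-elim)
open import Function.Base using (_∘_)
open import Function.Bundles using (_⇔_; mk⇔)
open import Function.Definitions using (Injective)
open import Relation.Nullary using (¬_; yes; no)
open import Relation.Binary.Bundles using (Setoid)
import Relation.Binary.Reasoning.Setoid
open import Relation.Binary.PropositionalEquality as ≡ using (_≡_)
open import Algebra.Bundles using (CommutativeRing)

↑-elim : ∀ {a} p k (P : Fin (p ℕ+ k) → Set a) →
         (∀ i → P (i ↑ˡ k)) → (∀ i → P (p ↑ʳ i)) → ∀ i → P i
↑-elim p k P left right i with splitAt p i in eq
... | inj₁ i′ = ≡.subst P (splitAt⁻¹-↑ˡ eq) (left i′)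
... | inj₂ i′ = ≡.subst P (splitAt⁻¹-↑ʳ eq) (right i′)

↑ʳ≢↑ˡ : ∀ p {k} (i : Fin k) (j : Fin p) → ¬ (p ↑ʳ i ≡ j ↑ˡ k)
↑ʳ≢↑ˡ p {k} i j eq
  with ≡.trans (≡.sym (splitAt-↑ʳ p k i)) (≡.trans (≡.cong (splitAt p) eq) (splitAt-↑ˡ p j k))
... | ()

opposite-injective : ∀ {n} → Injective _≡_ _≡_ (opposite {n})
opposite-injective {x = x} {y} eq =
  ≡.trans (≡.sym (opposite-involutive x)) (≡.trans (≡.cong opposite eq) (opposite-involutive y))

module Sums {c ℓ} (K : CommutativeRing c ℓ) where
  open LinAlg K
  open CommutativeRing K
    using (setoid; semiring; refl; sym; trans; +-cong; +-congˡ; +-congʳ; *-congʳ;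
           +-assoc; +-identityˡ; +-identityʳ; *-identityˡ; zeroˡ)
  open import Algebra.Properties.Semiring.Sum semiring
    using (sum; sum-cong-≋; sum-cong-≗; sum-replicate-zero; ∑-comm; *-distribˡ-sum; *-distribʳ-sum)
  module ≈-Reasoning = Relation.Binary.Reasoning.Setoid setoid
  open ≈-Reasoning

  ≡⇒≈ : ∀ {x y} → x ≡ y → x ≈ y
  ≡⇒≈ ≡.refl = refl

  Σ≡sum : ∀ n (f : Fin n → Carrier) → Σ[ n ] f ≡ sum f
  Σ≡sum zero f = ≡.refl
  Σ≡sum (suc n) f = ≡.cong (f zero +_) (Σ≡sum n (λ i → f (suc i)))

  Σ-cong : ∀ n {f g : Fin n → Carrier} → (∀ i → f i ≈ g i) → Σ[ n ] f ≈ Σ[ n ] g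
  Σ-cong n {f} {g} f≈g = begin
    Σ[ n ] f ≡⟨ Σ≡sum n f ⟩
    sum f    ≈⟨ sum-cong-≋ f≈g ⟩
    sum g    ≡⟨ Σ≡sum n g ⟨
    Σ[ n ] g ∎

  Σ-zero : ∀ n {f : Fin n → Carrier} → (∀ i → f i ≈ 0#) → Σ[ n ] f ≈ 0#
  Σ-zero n {f} f≈0 = begin
    Σ[ n ] f           ≈⟨ Σ-cong n f≈0 ⟩
    Σ[ n ] (λ _ → 0#)  ≡⟨ Σ≡sum n _ ⟩
    sum {n} (λ _ → 0#) ≈⟨ sum-replicate-zero n ⟩
    0#                 ∎

  *-distribˡ-Σ : ∀ n x (f : Fin n → Carrier) → x * Σ[ n ] f ≈ Σ[ n ] (λ i → x * f i)
  *-distribˡ-Σ n x f = begin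
    x * Σ[ n ] f              ≡⟨ ≡.cong (x *_) (Σ≡sum n f) ⟩
    x * sum f                 ≈⟨ *-distribˡ-sum x f ⟩
    sum (λ i → x * f i)       ≡⟨ Σ≡sum n _ ⟨
    Σ[ n ] (λ i → x * f i)    ∎

  *-distribʳ-Σ : ∀ n x (f : Fin n → Carrier) → Σ[ n ] f * x ≈ Σ[ n ] (λ i → f i * x)
  *-distribʳ-Σ n x f = begin
    Σ[ n ] f * x              ≡⟨ ≡.cong (_* x) (Σ≡sum n f) ⟩
    sum f * x                 ≈⟨ *-distribʳ-sum x f ⟩
    sum (λ i → f i * x)       ≡⟨ Σ≡sum n _ ⟨
    Σ[ n ] (λ i → f i * x)    ∎

  Σ-comm : ∀ m n (f : Fin m → Fin n → Carrier) →
           Σ[ m ] (λ i → Σ[ n ] (f i)) ≈ Σ[ n ] (λ j → Σ[ m ] (λ i → f i j))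
  Σ-comm m n f = begin
    Σ[ m ] (λ i → Σ[ n ] (f i))           ≡⟨ ≡.trans (Σ≡sum m _) (sum-cong-≗ (λ i → Σ≡sum n (f i))) ⟩
    sum (λ i → sum (f i))                 ≈⟨ ∑-comm f ⟩
    sum (λ j → sum (λ i → f i j))         ≡⟨ ≡.trans (Σ≡sum n _) (sum-cong-≗ (λ j → Σ≡sum m (λ i → f i j))) ⟨
    Σ[ n ] (λ j → Σ[ m ] (λ i → f i j))   ∎

  Σ-↑ : ∀ p k (f : Fin (p ℕ+ k) → Carrier) →
        Σ[ p ℕ+ k ] f ≈ Σ[ p ] (λ i → f (i ↑ˡ k)) + Σ[ k ] (λ i → f (p ↑ʳ i))
  Σ-↑ zero k f = sym (+-identityˡ _)
  Σ-↑ (suc p) k f = trans (+-congˡ (Σ-↑ p k (λ i → f (suc i)))) (sym (+-assoc _ _ _))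

  Σ-↑ˡ : ∀ p k (f : Fin (p ℕ+ k) → Carrier) → (∀ i → f (p ↑ʳ i) ≈ 0#) →
         Σ[ p ℕ+ k ] f ≈ Σ[ p ] (λ i → f (i ↑ˡ k))
  Σ-↑ˡ p k f f≈0 = trans (Σ-↑ p k f) (trans (+-congˡ (Σ-zero k f≈0)) (+-identityʳ _))

  Σ-↑ʳ : ∀ p k (f : Fin (p ℕ+ k) → Carrier) → (∀ i → f (i ↑ˡ k) ≈ 0#) →
         Σ[ p ℕ+ k ] f ≈ Σ[ k ] (λ i → f (p ↑ʳ i))
  Σ-↑ʳ p k f f≈0 = trans (Σ-↑ p k f) (trans (+-congʳ (Σ-zero p f≈0)) (+-identityˡ _))

  δ-refl : ∀ {n} (i : Fin n) → δ i i ≡ 1#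
  δ-refl i with i ≟ i
  ... | yes _ = ≡.refl
  ... | no i≢i = ⊥-elim (i≢i ≡.refl)

  δ-≢ : ∀ {n} {i j : Fin n} → ¬ (i ≡ j) → δ i j ≡ 0#
  δ-≢ {i = i} {j} i≢j with i ≟ j
  ... | yes i≡j = ⊥-elim (i≢j i≡j)
  ... | no _ = ≡.refl

  δ-sym : ∀ {n} (i j : Fin n) → δ i j ≡ δ j i
  δ-sym i j with i ≟ j | j ≟ i
  ... | yes _   | yes _   = ≡.refl
  ... | no _    | no _    = ≡.refl
  ... | yes i≡j | no j≢i  = ⊥-elim (j≢i (≡.sym i≡j))
  ... | no i≢j  | yes j≡i = ⊥-elim (i≢j (≡.sym j≡i))

  δ-injective : ∀ {m n} {f : Fin m → Fin n} → Injective _≡_ _≡_ f → ∀ i j → δ (f i) (f j) ≡ δ i j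
  δ-injective {f = f} f-inj i j with i ≟ j
  ... | yes ≡.refl = δ-refl (f i)
  ... | no i≢j = δ-≢ (i≢j ∘ f-inj)

  Σ-δ : ∀ n (k : Fin n) (f : Fin n → Carrier) → Σ[ n ] (λ i → δ k i * f i) ≈ f k
  Σ-δ (suc n) zero f = begin
    δ {suc n} zero zero * f zero + Σ[ n ] (λ i → δ zero (suc i) * f (suc i))
      ≈⟨ +-cong (trans (*-congʳ (≡⇒≈ (δ-refl {suc n} zero))) (*-identityˡ _))
                (Σ-zero n (λ i → trans (*-congʳ (≡⇒≈ (δ-≢ {i = zero} {suc i} λ ()))) (zeroˡ _))) ⟩
    f zero + 0#   ≈⟨ +-identityʳ _ ⟩
    f zero        ∎
  Σ-δ (suc n) (suc k) f = begin
    δ (suc k) zero * f zero + Σ[ n ] (λ i → δ (suc k) (suc i) * f (suc i))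
      ≈⟨ +-cong (trans (*-congʳ (≡⇒≈ (δ-≢ {i = suc k} {zero} λ ()))) (zeroˡ _))
                (Σ-cong n (λ i → *-congʳ (≡⇒≈ (δ-injective suc-injective k i)))) ⟩
    0# + Σ[ n ] (λ i → δ k i * f (suc i)) ≈⟨ +-identityˡ _ ⟩
    Σ[ n ] (λ i → δ k i * f (suc i))      ≈⟨ Σ-δ n k (λ i → f (suc i)) ⟩
    f (suc k)                             ∎

module Matrices {c ℓ} (K : CommutativeRing c ℓ) where
  open LinAlg K
  open CommutativeRing K
    using (refl; sym; trans; *-cong; *-congˡ; *-congʳ; *-comm; *-assoc; *-identityˡ; zeroˡ; zeroʳ)
  open Sums K

  ≈M-setoid : ℕ → ℕ → Setoid c ℓ
  ≈M-setoid m n = record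
    { Carrier = Mat m n
    ; _≈_ = _≈M_
    ; isEquivalence = record
      { refl = λ i j → refl
      ; sym = λ A≈B i j → sym (A≈B i j)
      ; trans = λ A≈B B≈C i j → trans (A≈B i j) (B≈C i j)
      }
    }

  module ≈M-Reasoning {m n} = Relation.Binary.Reasoning.Setoid (≈M-setoid m n)

  ≈M-sym : ∀ {m n} {A B : Mat m n} → A ≈M B → B ≈M A
  ≈M-sym = Setoid.sym (≈M-setoid _ _)

  ≈M-trans : ∀ {m n} {A B C : Mat m n} → A ≈M B → B ≈M C → A ≈M C
  ≈M-trans = Setoid.trans (≈M-setoid _ _)

  *M-congˡ : ∀ {m n p} {A A′ : Mat m n} (B : Mat n p) → A ≈M A′ → (A *M B) ≈M (A′ *M B)
  *M-congˡ {n = n} B A≈A′ i j = Σ-cong n (λ k → *-congʳ (A≈A′ i k))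

  *M-congʳ : ∀ {m n p} (A : Mat m n) {B B′ : Mat n p} → B ≈M B′ → (A *M B) ≈M (A *M B′)
  *M-congʳ {n = n} A B≈B′ i j = Σ-cong n (λ k → *-congˡ (B≈B′ k j))

  *M-assoc : ∀ {m n p o} (A : Mat m n) (B : Mat n p) (C : Mat p o) →
             ((A *M B) *M C) ≈M (A *M (B *M C))
  *M-assoc {n = n} {p} A B C i j = begin
    Σ[ p ] (λ k → Σ[ n ] (λ l → A i l * B l k) * C k j)   ≈⟨ Σ-cong p (λ k → *-distribʳ-Σ n _ _) ⟩
    Σ[ p ] (λ k → Σ[ n ] (λ l → (A i l * B l k) * C k j)) ≈⟨ Σ-comm p n _ ⟩
    Σ[ n ] (λ l → Σ[ p ] (λ k → (A i l * B l k) * C k j)) ≈⟨ Σ-cong n (λ l → Σ-cong p (λ k → *-assoc _ _ _)) ⟩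
    Σ[ n ] (λ l → Σ[ p ] (λ k → A i l * (B l k * C k j))) ≈⟨ Σ-cong n (λ l → *-distribˡ-Σ p _ _) ⟨
    Σ[ n ] (λ l → A i l * Σ[ p ] (λ k → B l k * C k j))   ∎
    where open ≈-Reasoning

  *M-identityˡ : ∀ {m n} (A : Mat m n) → (I m *M A) ≈M A
  *M-identityˡ {m} A i j = Σ-δ m i (λ k → A k j)

  *M-identityʳ : ∀ {m n} (A : Mat m n) → (A *M I n) ≈M A
  *M-identityʳ {n = n} A i j = begin
    Σ[ n ] (λ k → A i k * δ k j) ≈⟨ Σ-cong n (λ k → trans (*-comm _ _) (*-congʳ (≡⇒≈ (δ-sym k j)))) ⟩
    Σ[ n ] (λ k → δ j k * A i k) ≈⟨ Σ-δ n j (A i) ⟩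
    A i j                        ∎
    where open ≈-Reasoning

  *M-zero-col : ∀ {m n p} (A : Mat m n) (B : Mat n p) {i j} →
                (∀ k → B k j ≈ 0#) → (A *M B) i j ≈ 0#
  *M-zero-col {n = n} A B B≈0 = Σ-zero n (λ k → trans (*-congˡ (B≈0 k)) (zeroʳ _))

  *M-zero-row : ∀ {m n p} (A : Mat m n) (B : Mat n p) {i j} →
                (∀ k → A i k ≈ 0#) → (A *M B) i j ≈ 0#
  *M-zero-row {n = n} A B A≈0 = Σ-zero n (λ k → trans (*-congʳ (A≈0 k)) (zeroˡ _))

  ·M-congʳ : ∀ {m n} x {A B : Mat m n} → A ≈M B → (x ·M A) ≈M (x ·M B)
  ·M-congʳ x A≈B i j = *-congˡ (A≈B i j)

  ·M-congˡ : ∀ {m n} {x y} (A : Mat m n) → x ≈ y → (x ·M A) ≈M (y ·M A)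
  ·M-congˡ A x≈y i j = *-congʳ x≈y

  ·M-*M : ∀ {m n p} x (A : Mat m n) (B : Mat n p) → ((x ·M A) *M B) ≈M (x ·M (A *M B))
  ·M-*M {n = n} x A B i j =
    trans (Σ-cong n (λ k → *-assoc _ _ _)) (sym (*-distribˡ-Σ n x _))

  *M-·M : ∀ {m n p} x (A : Mat m n) (B : Mat n p) → (A *M (x ·M B)) ≈M (x ·M (A *M B))
  *M-·M {n = n} x A B i j = begin
    Σ[ n ] (λ k → A i k * (x * B k j)) ≈⟨ Σ-cong n (λ k → trans (*-congˡ (*-comm _ _)) (sym (*-assoc _ _ _))) ⟩
    Σ[ n ] (λ k → (A i k * B k j) * x) ≈⟨ *-distribʳ-Σ n x _ ⟨
    (A *M B) i j * x                   ≈⟨ *-comm _ _ ⟩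
    x * (A *M B) i j                   ∎
    where open ≈-Reasoning

  ·M-assoc : ∀ {m n} x y (A : Mat m n) → (x ·M (y ·M A)) ≈M ((x * y) ·M A)
  ·M-assoc x y A i j = sym (*-assoc x y (A i j))

  ·M-identity : ∀ {m n} (A : Mat m n) → (1# ·M A) ≈M A
  ·M-identity A i j = *-identityˡ (A i j)

  transpose-*M : ∀ {m n p} (A : Mat m n) (B : Mat n p) →
                 transpose (A *M B) ≈M (transpose B *M transpose A)
  transpose-*M {n = n} A B i j = Σ-cong n (λ k → *-comm _ _)

  transpose-I : ∀ n → transpose (I n) ≈M I n
  transpose-I n i j = ≡⇒≈ (δ-sym j i)

  transpose-rightInverse : ∀ {m n} {A : Mat m n} {B : Mat n m} → (A *M B) ≈M I m →
                           (transpose B *M transpose A) ≈M I m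
  transpose-rightInverse {m} {A = A} {B} AB≈I = begin
    transpose B *M transpose A ≈⟨ ≈M-sym (transpose-*M A B) ⟩
    transpose (A *M B)         ≈⟨ (λ i j → AB≈I j i) ⟩
    transpose (I m)            ≈⟨ transpose-I m ⟩
    I m                        ∎
    where open ≈M-Reasoning

  inverse-unique : ∀ {n} {L A S : Mat n n} → (L *M A) ≈M I n → (A *M S) ≈M I n → S ≈M L
  inverse-unique {n} {L} {A} {S} LA≈I AS≈I = begin
    S              ≈⟨ *M-identityˡ S ⟨
    I n *M S       ≈⟨ *M-congˡ S LA≈I ⟨
    (L *M A) *M S  ≈⟨ *M-assoc L A S ⟩
    L *M (A *M S)  ≈⟨ *M-congʳ L AS≈I ⟩
    L *M I n       ≈⟨ *M-identityʳ L ⟩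
    L              ∎
    where open ≈M-Reasoning

  rows : ∀ {k m n} → (Fin k → Fin m) → Mat m n → Mat k n
  rows ι A s j = A (ι s) j

  cols : ∀ {k m n} → (Fin k → Fin n) → Mat m n → Mat m k
  cols ι B i s = B i (ι s)

  rows-*M-cols : ∀ {k n} {ι : Fin k → Fin n} {A B : Mat n n} → Injective _≡_ _≡_ ι →
                 (A *M B) ≈M I n → (rows ι A *M cols ι B) ≈M I k
  rows-*M-cols ι-inj AB≈I s t = trans (AB≈I _ _) (≡⇒≈ (δ-injective ι-inj s t))

  cancelˡ : ∀ {m n k} {L : Mat k m} {X : Mat m k} {Y : Mat k n} {C : Mat m n} →
            (L *M X) ≈M I k → (X *M Y) ≈M C → Y ≈M (L *M C)
  cancelˡ {k = k} {L} {X} {Y} {C} LX≈I XY≈C = begin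
    Y              ≈⟨ *M-identityˡ Y ⟨
    I k *M Y       ≈⟨ *M-congˡ Y LX≈I ⟨
    (L *M X) *M Y  ≈⟨ *M-assoc L X Y ⟩
    L *M (X *M Y)  ≈⟨ *M-congʳ L XY≈C ⟩
    L *M C         ∎
    where open ≈M-Reasoning

  cancelʳ : ∀ {m n k} {X : Mat m k} {Y : Mat k n} {R : Mat n k} {C : Mat m n} →
            (Y *M R) ≈M I k → (X *M Y) ≈M C → X ≈M (C *M R)
  cancelʳ {k = k} {X} {Y} {R} {C} YR≈I XY≈C = begin
    X              ≈⟨ *M-identityʳ X ⟨
    X *M I k       ≈⟨ *M-congʳ X YR≈I ⟨
    X *M (Y *M R)  ≈⟨ *M-assoc X Y R ⟨
    (X *M Y) *M R  ≈⟨ *M-congˡ R XY≈C ⟩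
    C *M R         ∎
    where open ≈M-Reasoning

  w̃-*M : ∀ {n p} (A : Mat n p) i j → (w̃ n *M A) i j ≈ A (opposite i) j
  w̃-*M {n} A i j = Σ-δ n (opposite i) (λ k → A k j)

  w̃-involutive : ∀ n → (w̃ n *M w̃ n) ≈M I n
  w̃-involutive n i j = trans (w̃-*M (w̃ n) i j) (≡⇒≈ (≡.cong (λ x → δ x j) (opposite-involutive i)))

  transpose-w̃ : ∀ n → transpose (w̃ n) ≈M w̃ n
  transpose-w̃ n i j = ≡⇒≈ (begin
    δ (opposite j) i                         ≡⟨ ≡.cong (δ (opposite j)) (opposite-involutive i) ⟨
    δ (opposite j) (opposite (opposite i))   ≡⟨ δ-injective opposite-injective j (opposite i) ⟩
    δ j (opposite i)                         ≡⟨ δ-sym j (opposite i) ⟩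
    δ (opposite i) j                         ∎)
    where open ≡.≡-Reasoning

  t-cong : ∀ {m n} {h h′ : Mat m m} {g g′ : Mat n n} → h ≈M h′ → g ≈M g′ → t h g ≈T t h′ g′
  t-cong h≈h′ g≈g′ (i , a) (j , b) = *-cong (h≈h′ i j) (g≈g′ a b)

  ·T-congʳ : ∀ {m n} v {X Y : (Fin m × Fin n) → (Fin m × Fin n) → Carrier} →
             X ≈T Y → ∀ x → (v ·T X) x ≈ (v ·T Y) x
  ·T-congʳ {m} {n} v X≈Y (j , b) = Σ-cong m (λ i → Σ-cong n (λ a → *-congˡ (X≈Y (i , a) (j , b))))

  entry-subst : ∀ {m n} (M : Mat m n) {i i′ j j′ z} → i′ ≡ i → j′ ≡ j → M i′ j′ ≈ z → M i j ≈ z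
  entry-subst M ≡.refl ≡.refl M≈z = M≈z

  module Blocks (p k : ℕ) where

    topLeft : Mat (p ℕ+ k) (p ℕ+ k) → Mat p p
    topLeft M i j = M (i ↑ˡ k) (j ↑ˡ k)

    topRight : Mat (p ℕ+ k) (p ℕ+ k) → Mat p k
    topRight M i j = M (i ↑ˡ k) (p ↑ʳ j)

    bottomLeft : Mat (p ℕ+ k) (p ℕ+ k) → Mat k p
    bottomLeft M i j = M (p ↑ʳ i) (j ↑ˡ k)

    bottomRight : Mat (p ℕ+ k) (p ℕ+ k) → Mat k k
    bottomRight M i j = M (p ↑ʳ i) (p ↑ʳ j)

    BlockUpperTriangular : Mat (p ℕ+ k) (p ℕ+ k) → Set ℓ
    BlockUpperTriangular M = ∀ i j → bottomLeft M i j ≈ 0#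

    upperBlock-blockUpperTriangular : ∀ (A : Mat p p) (B : Mat p k) (D : Mat k k) →
                                      BlockUpperTriangular (upperBlock A B D)
    upperBlock-blockUpperTriangular A B D i j
      rewrite splitAt-↑ʳ p k i | splitAt-↑ˡ p j k = refl

    bottomRight-upperBlock : ∀ (A : Mat p p) (B : Mat p k) (D : Mat k k) →
                             bottomRight (upperBlock A B D) ≈M D
    bottomRight-upperBlock A B D i j
      rewrite splitAt-↑ʳ p k i | splitAt-↑ʳ p k j = refl

    ≈M-upperBlock : ∀ {M D} → BlockUpperTriangular M → bottomRight M ≈M D →
                    M ≈M upperBlock (topLeft M) (topRight M) D
    ≈M-upperBlock {M} M-BUT M₂₂≈D i j with splitAt p i in i≡ | splitAt p j in j≡
    ... | inj₁ i′ | inj₁ j′ = entry-subst M (splitAt⁻¹-↑ˡ i≡) (splitAt⁻¹-↑ˡ j≡) refl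
    ... | inj₁ i′ | inj₂ j′ = entry-subst M (splitAt⁻¹-↑ˡ i≡) (splitAt⁻¹-↑ʳ j≡) refl
    ... | inj₂ i′ | inj₁ j′ = entry-subst M (splitAt⁻¹-↑ʳ i≡) (splitAt⁻¹-↑ˡ j≡) (M-BUT i′ j′)
    ... | inj₂ i′ | inj₂ j′ = entry-subst M (splitAt⁻¹-↑ʳ i≡) (splitAt⁻¹-↑ʳ j≡) (M₂₂≈D i′ j′)

    *M-bottomRows : ∀ {n} M (N : Mat (p ℕ+ k) n) → BlockUpperTriangular M →
                    rows (p ↑ʳ_) (M *M N) ≈M (bottomRight M *M rows (p ↑ʳ_) N)
    *M-bottomRows M N M-BUT u j =
      Σ-↑ʳ p k _ (λ l → trans (*-congʳ (M-BUT u l)) (zeroˡ _))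

    *M-topLeft : ∀ M N → BlockUpperTriangular N →
                 topLeft (M *M N) ≈M (topLeft M *M topLeft N)
    *M-topLeft M N N-BUT i j =
      Σ-↑ˡ p k _ (λ l → trans (*-congˡ (N-BUT l j)) (zeroʳ _))

    -- M G = I only yields a right inverse of the lower right block; its left
    -- inverse has to be supplied, as there are no determinants to conclude.
    blockUpperTriangular-GL : ∀ {M} → BlockUpperTriangular M → GL M →
                         (∃ λ L → (L *M bottomRight M) ≈M I k) → GL (topLeft M) × GL (bottomRight M)
    blockUpperTriangular-GL {M} M-BUT (G , MG≈I , GM≈I) (L , LD≈I) =
      (topLeft G , A*A′≈I , A′*A≈I) , (bottomRight G , D*D′≈I , D′*D≈I)
      where
      D = bottomRight M

      D*G₂₁≈0 : ∀ u b → (D *M bottomLeft G) u b ≈ 0#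
      D*G₂₁≈0 u b = begin
        (D *M bottomLeft G) u b    ≈⟨ *M-bottomRows M G M-BUT u (b ↑ˡ k) ⟨
        (M *M G) (p ↑ʳ u) (b ↑ˡ k) ≈⟨ MG≈I _ _ ⟩
        δ (p ↑ʳ u) (b ↑ˡ k)        ≡⟨ δ-≢ (↑ʳ≢↑ˡ p u b) ⟩
        0#                         ∎
        where open ≈-Reasoning

      G-BUT : BlockUpperTriangular G
      G-BUT u b = begin
        bottomLeft G u b                ≈⟨ cancelˡ {L = L} {X = D} {Y = bottomLeft G} LD≈I (λ _ _ → refl) u b ⟩
        (L *M (D *M bottomLeft G)) u b  ≈⟨ *M-zero-col L (D *M bottomLeft G) (λ v → D*G₂₁≈0 v b) ⟩
        0#                              ∎
        where open ≈-Reasoning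

      D*D′≈I : (D *M bottomRight G) ≈M I k
      D*D′≈I u v = trans (sym (*M-bottomRows M G M-BUT u (p ↑ʳ v)))
                         (trans (MG≈I (p ↑ʳ u) (p ↑ʳ v)) (≡⇒≈ (δ-injective (↑ʳ-injective p _ _) u v)))

      D′*D≈I : (bottomRight G *M D) ≈M I k
      D′*D≈I u v = trans (*M-congˡ D (inverse-unique LD≈I D*D′≈I) u v) (LD≈I u v)

      A*A′≈I : (topLeft M *M topLeft G) ≈M I p
      A*A′≈I i j = trans (sym (*M-topLeft M G G-BUT i j))
                         (trans (MG≈I (i ↑ˡ k) (j ↑ˡ k)) (≡⇒≈ (δ-injective (↑ˡ-injective k _ _) i j)))

      A′*A≈I : (topLeft G *M topLeft M) ≈M I p
      A′*A≈I i j = trans (sym (*M-topLeft G M M-BUT i j))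
                         (trans (GM≈I (i ↑ˡ k) (j ↑ˡ k)) (≡⇒≈ (δ-injective (↑ˡ-injective k _ _) i j)))

  -- D = λ′ d* with the inverses cleared, using d* = w̃⁻¹ (dᵀ)⁻¹ w̃ and w̃⁻¹ = w̃.
  CornerRelation : ∀ {k} → Carrier → Mat k k → Mat k k → Set ℓ
  CornerRelation {k} λ′ D d = (transpose D *M (w̃ k *M d)) ≈M (λ′ ·M w̃ k)

  corner-sym : ∀ {k λ′} {D d : Mat k k} → CornerRelation λ′ D d → CornerRelation λ′ d D
  corner-sym {k} {λ′} {D} {d} C = begin
    transpose d *M (w̃ k *M D)            ≈⟨ *M-assoc (transpose d) (w̃ k) D ⟨
    (transpose d *M w̃ k) *M D            ≈⟨ *M-congˡ D (*M-congʳ (transpose d) (transpose-w̃ k)) ⟨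
    (transpose d *M transpose (w̃ k)) *M D ≈⟨ *M-congˡ D (transpose-*M (w̃ k) d) ⟨
    transpose (w̃ k *M d) *M D            ≈⟨ transpose-*M (transpose D) (w̃ k *M d) ⟨
    transpose (transpose D *M (w̃ k *M d)) ≈⟨ (λ i j → C j i) ⟩
    λ′ ·M transpose (w̃ k)                ≈⟨ ·M-congʳ λ′ (transpose-w̃ k) ⟩
    λ′ ·M w̃ k                            ∎
    where open ≈M-Reasoning

  corner⇒leftInvertible : ∀ {k λ′ μ} {D d : Mat k k} → λ′ * μ ≈ 1# → CornerRelation λ′ D d →
                          ∃ λ L → (L *M d) ≈M I k
  corner⇒leftInvertible {k} {λ′} {μ} {D} {d} λ′μ≈1 C = L , Ld≈I
    where
    open ≈M-Reasoning
    Dᵀ = transpose D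
    L = μ ·M (w̃ k *M (Dᵀ *M w̃ k))
    Ld≈I : (L *M d) ≈M I k
    Ld≈I = begin
      L *M d                             ≈⟨ ·M-*M μ _ d ⟩
      μ ·M ((w̃ k *M (Dᵀ *M w̃ k)) *M d)   ≈⟨ ·M-congʳ μ (*M-assoc (w̃ k) _ d) ⟩
      μ ·M (w̃ k *M ((Dᵀ *M w̃ k) *M d))   ≈⟨ ·M-congʳ μ (*M-congʳ (w̃ k) (*M-assoc Dᵀ (w̃ k) d)) ⟩
      μ ·M (w̃ k *M (Dᵀ *M (w̃ k *M d)))   ≈⟨ ·M-congʳ μ (*M-congʳ (w̃ k) C) ⟩
      μ ·M (w̃ k *M (λ′ ·M w̃ k))          ≈⟨ ·M-congʳ μ (*M-·M λ′ (w̃ k) (w̃ k)) ⟩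
      μ ·M (λ′ ·M (w̃ k *M w̃ k))          ≈⟨ ·M-assoc μ λ′ _ ⟩
      (μ * λ′) ·M (w̃ k *M w̃ k)           ≈⟨ ·M-congˡ _ (trans (*-comm μ λ′) λ′μ≈1) ⟩
      1# ·M (w̃ k *M w̃ k)                 ≈⟨ ·M-identity _ ⟩
      w̃ k *M w̃ k                         ≈⟨ w̃-involutive k ⟩
      I k                                ∎

  corner⇒star-multiple : ∀ {k λ′} {D d S : Mat k k} → CornerRelation λ′ D d → (d *M S) ≈M I k →
                D ≈M (λ′ ·M star d (transpose S) (w̃ k))
  corner⇒star-multiple {k} {λ′} {D} {d} {S} C dS≈I = begin
    D                                 ≈⟨ *M-identityˡ D ⟨
    I k *M D                          ≈⟨ *M-congˡ D (w̃-involutive k) ⟨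
    (w̃ k *M w̃ k) *M D                 ≈⟨ *M-assoc (w̃ k) (w̃ k) D ⟩
    w̃ k *M (w̃ k *M D)                 ≈⟨ *M-congʳ (w̃ k) (*M-identityˡ _) ⟨
    w̃ k *M (I k *M (w̃ k *M D))        ≈⟨ *M-congʳ (w̃ k) (*M-congˡ _ (transpose-rightInverse {A = d} dS≈I)) ⟨
    w̃ k *M ((Sᵀ *M dᵀ) *M (w̃ k *M D)) ≈⟨ *M-congʳ (w̃ k) (*M-assoc Sᵀ dᵀ _) ⟩
    w̃ k *M (Sᵀ *M (dᵀ *M (w̃ k *M D))) ≈⟨ *M-congʳ (w̃ k) (*M-congʳ Sᵀ (corner-sym C)) ⟩
    w̃ k *M (Sᵀ *M (λ′ ·M w̃ k))        ≈⟨ *M-congʳ (w̃ k) (*M-·M λ′ Sᵀ (w̃ k)) ⟩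
    w̃ k *M (λ′ ·M (Sᵀ *M w̃ k))        ≈⟨ *M-·M λ′ (w̃ k) _ ⟩
    λ′ ·M (w̃ k *M (Sᵀ *M w̃ k))        ≈⟨ ·M-congʳ λ′ (*M-assoc (w̃ k) Sᵀ (w̃ k)) ⟨
    λ′ ·M ((w̃ k *M Sᵀ) *M w̃ k)        ∎
    where open ≈M-Reasoning
          Sᵀ = transpose S
          dᵀ = transpose d

  star-multiple⇒corner : ∀ {k λ′} {D d T : Mat k k} → (transpose d *M T) ≈M I k →
                D ≈M (λ′ ·M star d T (w̃ k)) → CornerRelation λ′ D d
  star-multiple⇒corner {k} {λ′} {D} {d} {T} dᵀT≈I D≈λd* = corner-sym (begin
    dᵀ *M (w̃ k *M D)                            ≈⟨ *M-congʳ dᵀ (*M-congʳ (w̃ k) D≈λd*) ⟩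
    dᵀ *M (w̃ k *M (λ′ ·M ((w̃ k *M T) *M w̃ k))) ≈⟨ *M-congʳ dᵀ (*M-·M λ′ (w̃ k) _) ⟩
    dᵀ *M (λ′ ·M (w̃ k *M ((w̃ k *M T) *M w̃ k))) ≈⟨ *M-·M λ′ dᵀ _ ⟩
    λ′ ·M (dᵀ *M (w̃ k *M ((w̃ k *M T) *M w̃ k))) ≈⟨ ·M-congʳ λ′ (*M-congʳ dᵀ w̃w̃T≈T) ⟩
    λ′ ·M (dᵀ *M (T *M w̃ k))                    ≈⟨ ·M-congʳ λ′ (*M-assoc dᵀ T (w̃ k)) ⟨
    λ′ ·M ((dᵀ *M T) *M w̃ k)                    ≈⟨ ·M-congʳ λ′ (*M-congˡ (w̃ k) dᵀT≈I) ⟩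
    λ′ ·M (I k *M w̃ k)                          ≈⟨ ·M-congʳ λ′ (*M-identityˡ (w̃ k)) ⟩
    λ′ ·M w̃ k                                   ∎)
    where open ≈M-Reasoning
          dᵀ = transpose d
          w̃w̃T≈T : (w̃ k *M ((w̃ k *M T) *M w̃ k)) ≈M (T *M w̃ k)
          w̃w̃T≈T = begin
            w̃ k *M ((w̃ k *M T) *M w̃ k) ≈⟨ *M-assoc (w̃ k) _ (w̃ k) ⟨
            (w̃ k *M (w̃ k *M T)) *M w̃ k ≈⟨ *M-congˡ (w̃ k) (*M-assoc (w̃ k) (w̃ k) T) ⟨
            ((w̃ k *M w̃ k) *M T) *M w̃ k ≈⟨ *M-congˡ (w̃ k) (*M-congˡ T (w̃-involutive k)) ⟩
            (I k *M T) *M w̃ k           ≈⟨ *M-congˡ (w̃ k) (*M-identityˡ T) ⟩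
            T *M w̃ k                    ∎

module EigenvectorOfKronecker {c ℓ} (K : CommutativeRing c ℓ) (p q r : ℕ) where
  open LinAlg K
  open CommutativeRing K using (refl; sym; trans; *-congˡ; *-congʳ; zeroˡ; zeroʳ)
  open Sums K
  open Matrices K
  module m-Blocks = Blocks p (suc r)
  module n-Blocks = Blocks q (suc r)

  m n : ℕ
  m = p ℕ+ suc r
  n = q ℕ+ suc r

  V : Mat m n
  V j b = vvec p q r (j , b)

  V-top : ∀ i b → V (i ↑ˡ suc r) b ≡ 0#
  V-top i b rewrite splitAt-↑ˡ p i (suc r) = ≡.refl

  V-bottom : ∀ s b → V (p ↑ʳ s) b ≡ δ (q ↑ʳ opposite s) b
  V-bottom s b rewrite splitAt-↑ʳ p (suc r) s = ≡.refl

  V-left : ∀ j b → V j (b ↑ˡ suc r) ≡ 0#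
  V-left j b with splitAt p j
  ... | inj₁ _ = ≡.refl
  ... | inj₂ s = δ-≢ (↑ʳ≢↑ˡ q (opposite s) b)

  V-corner : ∀ s u → V (p ↑ʳ s) (q ↑ʳ u) ≡ w̃ (suc r) s u
  V-corner s u = ≡.trans (V-bottom s (q ↑ʳ u)) (δ-injective (↑ʳ-injective q _ _) (opposite s) u)

  -- Entry (j , b) of v·t(h,g) = hᵀ V g is (X h *M Y g) j b: the support of V pairs
  -- row p+s of h with row q+(r−s) of g.
  X : Mat m m → Mat m (suc r)
  X h = transpose (rows (p ↑ʳ_) h)

  Y : Mat n n → Mat (suc r) n
  Y g = rows ((q ↑ʳ_) ∘ opposite) g

  vvec-·T-t : ∀ h g j b → (vvec p q r ·T t h g) (j , b) ≈ (X h *M Y g) j b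
  vvec-·T-t h g j b = begin
    Σ[ m ] (λ i → Σ[ n ] (λ a → V i a * (h i j * g a b)))
      ≈⟨ Σ-↑ʳ p (suc r) _ (λ i → Σ-zero n (λ a → trans (*-congʳ (≡⇒≈ (V-top i a))) (zeroˡ _))) ⟩
    Σ[ suc r ] (λ s → Σ[ n ] (λ a → V (p ↑ʳ s) a * (h (p ↑ʳ s) j * g a b)))
      ≈⟨ Σ-cong (suc r) (λ s → trans (Σ-cong n (λ a → *-congʳ (≡⇒≈ (V-bottom s a))))
                                     (Σ-δ n (q ↑ʳ opposite s) (λ a → h (p ↑ʳ s) j * g a b))) ⟩
    (X h *M Y g) j b
      ∎
    where open ≈-Reasoning

  corner-entry : ∀ h g s u →
    (transpose (m-Blocks.bottomRight h) *M (w̃ (suc r) *M n-Blocks.bottomRight g)) s u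
      ≈ (X h *M Y g) (p ↑ʳ s) (q ↑ʳ u)
  corner-entry h g s u =
    Σ-cong (suc r) (λ l → *-congˡ {h (p ↑ʳ l) (p ↑ʳ s)} (w̃-*M (n-Blocks.bottomRight g) l u))

  product⇒corner : ∀ {h g λ′} → (X h *M Y g) ≈M (λ′ ·M V) →
    CornerRelation λ′ (m-Blocks.bottomRight h) (n-Blocks.bottomRight g)
  product⇒corner {h} {g} XY≈λV s u =
    trans (corner-entry h g s u) (trans (XY≈λV _ _) (*-congˡ (≡⇒≈ (V-corner s u))))

  product⇒blockUpperTriangular : ∀ {h g λ′} → GL h → GL g → (X h *M Y g) ≈M (λ′ ·M V) →
    m-Blocks.BlockUpperTriangular h × n-Blocks.BlockUpperTriangular g
  product⇒blockUpperTriangular {h} {g} {λ′} (H , hH≈I , _) (G , gG≈I , _) XY≈λV =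
    h-BUT , g-BUT
    where
    L : Mat (suc r) m
    L = transpose (cols (p ↑ʳ_) H)

    R : Mat n (suc r)
    R = cols ((q ↑ʳ_) ∘ opposite) G

    reversed-↑ʳ-injective : Injective _≡_ _≡_ ((q ↑ʳ_) ∘ opposite {suc r})
    reversed-↑ʳ-injective {x} {y} eq = opposite-injective (↑ʳ-injective q (opposite x) (opposite y) eq)

    LX≈I : (L *M X h) ≈M I (suc r)
    LX≈I = transpose-rightInverse {A = rows (p ↑ʳ_) h} (rows-*M-cols (↑ʳ-injective p _ _) hH≈I)

    YR≈I : (Y g *M R) ≈M I (suc r)
    YR≈I = rows-*M-cols reversed-↑ʳ-injective gG≈I

    h-BUT : m-Blocks.BlockUpperTriangular h
    h-BUT s j = begin
      X h (j ↑ˡ suc r) s              ≈⟨ cancelʳ {X = X h} YR≈I XY≈λV (j ↑ˡ suc r) s ⟩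
      ((λ′ ·M V) *M R) (j ↑ˡ suc r) s ≈⟨ *M-zero-row (λ′ ·M V) R {j ↑ˡ suc r} {s}
                                           (λ b → trans (*-congˡ (≡⇒≈ (V-top j b))) (zeroʳ λ′)) ⟩
      0#                              ∎
      where open ≈-Reasoning

    g-BUT′ : ∀ s b → Y g s (b ↑ˡ suc r) ≈ 0#
    g-BUT′ s b = begin
      Y g s (b ↑ˡ suc r)              ≈⟨ cancelˡ {Y = Y g} LX≈I XY≈λV s (b ↑ˡ suc r) ⟩
      (L *M (λ′ ·M V)) s (b ↑ˡ suc r) ≈⟨ *M-zero-col L (λ′ ·M V)
                                           (λ j → trans (*-congˡ (≡⇒≈ (V-left j b))) (zeroʳ λ′)) ⟩
      0#                              ∎
      where open ≈-Reasoning

    g-BUT : n-Blocks.BlockUpperTriangular g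
    g-BUT u b = ≡.subst (λ x → g (q ↑ʳ x) (b ↑ˡ suc r) ≈ 0#) (opposite-involutive u) (g-BUT′ (opposite u) b)

  corner⇒product : ∀ {h g λ′} → m-Blocks.BlockUpperTriangular h → n-Blocks.BlockUpperTriangular g →
    CornerRelation λ′ (m-Blocks.bottomRight h) (n-Blocks.bottomRight g) → (X h *M Y g) ≈M (λ′ ·M V)
  corner⇒product {h} {g} {λ′} h-BUT g-BUT C =
    ↑-elim p (suc r) (λ j → ∀ b → (X h *M Y g) j b ≈ λ′ * V j b) top bottom
    where
    top : ∀ i b → (X h *M Y g) (i ↑ˡ suc r) b ≈ λ′ * V (i ↑ˡ suc r) b
    top i b = trans (*M-zero-row (X h) (Y g) (λ s → h-BUT s i))
                    (sym (trans (*-congˡ (≡⇒≈ (V-top i b))) (zeroʳ λ′)))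

    bottom : ∀ s b → (X h *M Y g) (p ↑ʳ s) b ≈ λ′ * V (p ↑ʳ s) b
    bottom s = ↑-elim q (suc r) (λ b → (X h *M Y g) (p ↑ʳ s) b ≈ λ′ * V (p ↑ʳ s) b)
      (λ b → trans (*M-zero-col (X h) (Y g) (λ l → g-BUT (opposite l) b))
                   (sym (trans (*-congˡ (≡⇒≈ (V-left (p ↑ʳ s) b))) (zeroʳ λ′))))
      (λ u → trans (sym (corner-entry h g s u)) (trans (C s u) (*-congˡ (≡⇒≈ (≡.sym (V-corner s u))))))

  IsEigenvector : Mat m m → Mat n n → Carrier → Set ℓ
  IsEigenvector h g λ′ = ∀ x → (vvec p q r ·T t h g) x ≈ λ′ * vvec p q r x

  eigenvector⇒InTΔ : ∀ {h g λ′ μ} → GL h → GL g → ¬ (λ′ ≈ 0#) → λ′ * μ ≈ 1# →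
                     IsEigenvector h g λ′ → InTΔ p q r h g
  eigenvector⇒InTΔ {h} {g} {λ′} GLh GLg λ′≉0 λ′μ≈1 eigen =
    m-Blocks.topLeft h , m-Blocks.topRight h , n-Blocks.topLeft g , n-Blocks.topRight g ,
    d , λ′ , transpose S , w̃ (suc r) ,
    GLA , GLa , (S , dS≈I , Sd≈I) , λ′≉0 ,
    (transpose-rightInverse {A = S} {d} Sd≈I , transpose-rightInverse {A = d} {S} dS≈I) ,
    (w̃-involutive (suc r) , w̃-involutive (suc r)) ,
    t-cong (m-Blocks.≈M-upperBlock h-BUT D≈λd*) (n-Blocks.≈M-upperBlock g-BUT (λ _ _ → refl))
    where
    D d : Mat (suc r) (suc r)
    D = m-Blocks.bottomRight h
    d = n-Blocks.bottomRight g

    XY≈λV : (X h *M Y g) ≈M (λ′ ·M V)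
    XY≈λV j b = trans (sym (vvec-·T-t h g j b)) (eigen (j , b))

    C : CornerRelation λ′ D d
    C = product⇒corner {h} {g} XY≈λV

    h-BUT : m-Blocks.BlockUpperTriangular h
    h-BUT = proj₁ (product⇒blockUpperTriangular GLh GLg XY≈λV)

    g-BUT : n-Blocks.BlockUpperTriangular g
    g-BUT = proj₂ (product⇒blockUpperTriangular GLh GLg XY≈λV)

    GLA : GL (m-Blocks.topLeft h)
    GLA = proj₁ (m-Blocks.blockUpperTriangular-GL h-BUT GLh
                   (corner⇒leftInvertible {D = d} {D} λ′μ≈1 (corner-sym {D = D} {d} C)))

    GLa×GLd : GL (n-Blocks.topLeft g) × GL d
    GLa×GLd = n-Blocks.blockUpperTriangular-GL g-BUT GLg (corner⇒leftInvertible {D = D} {d} λ′μ≈1 C)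

    GLa : GL (n-Blocks.topLeft g)
    GLa = proj₁ GLa×GLd

    S : Mat (suc r) (suc r)
    S = proj₁ (proj₂ GLa×GLd)

    dS≈I : (d *M S) ≈M I (suc r)
    dS≈I = proj₁ (proj₂ (proj₂ GLa×GLd))

    Sd≈I : (S *M d) ≈M I (suc r)
    Sd≈I = proj₂ (proj₂ (proj₂ GLa×GLd))

    D≈λd* : D ≈M (λ′ ·M star d (transpose S) (w̃ (suc r)))
    D≈λd* = corner⇒star-multiple {D = D} {d} {S} C dS≈I

  InTΔ⇒eigenvector : ∀ {h g} → InTΔ p q r h g → ∃ λ λ′ → ¬ (λ′ ≈ 0#) × IsEigenvector h g λ′
  InTΔ⇒eigenvector {h} {g}
    (A , B , a , b , d , λ′ , T , W , _ , _ , _ , λ′≉0 , (dᵀT≈I , _) , (w̃W≈I , _) , t≈t′) =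
    λ′ , λ′≉0 , λ { (j , b) → trans (·T-congʳ (vvec p q r) t≈t′ (j , b))
                                (trans (vvec-·T-t h′ g′ j b) (X′Y′≈λV j b)) }
    where
    h′ = upperBlock A B (λ′ ·M star d T W)
    g′ = upperBlock a b d
    W≈w̃ : W ≈M w̃ (suc r)
    W≈w̃ = inverse-unique {L = w̃ (suc r)} {A = w̃ (suc r)} (w̃-involutive (suc r)) w̃W≈I
    D≈λd* : m-Blocks.bottomRight h′ ≈M (λ′ ·M star d T (w̃ (suc r)))
    D≈λd* = ≈M-trans (m-Blocks.bottomRight-upperBlock A B _)
                     (·M-congʳ λ′ (*M-congˡ (w̃ (suc r)) (*M-congˡ T W≈w̃)))
    d′ᵀT≈I : (transpose (n-Blocks.bottomRight g′) *M T) ≈M I (suc r)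
    d′ᵀT≈I = ≈M-trans (*M-congˡ T (λ i j → n-Blocks.bottomRight-upperBlock a b d j i)) dᵀT≈I
    X′Y′≈λV : (X h′ *M Y g′) ≈M (λ′ ·M V)
    X′Y′≈λV = corner⇒product {h′} {g′} (m-Blocks.upperBlock-blockUpperTriangular A B _)
                             (n-Blocks.upperBlock-blockUpperTriangular a b d)
                             (star-multiple⇒corner {d = n-Blocks.bottomRight g′} {T = T} d′ᵀT≈I D≈λd*)

lemma2p7 : ∀ {c ℓ} (K : CommutativeRing c ℓ) → IsNumberField K →
    (p q r : ℕ) → q ≤ p →
    let open LinAlg K
    in (h : Mat (p ℕ+ suc r) (p ℕ+ suc r)) (g : Mat (q ℕ+ suc r) (q ℕ+ suc r)) →
       GL h → GL g →
       ((∃ λ lam → ¬ (lam ≈ 0#) ×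
           (∀ x → (vvec p q r ·T t h g) x ≈ lam * vvec p q r x))
        ⇔ InTΔ p q r h g)
lemma2p7 K ((_ , inverse) , _) p q r _ h g GLh GLg =
  mk⇔ (λ (λ′ , λ′≉0 , eigen) →
         eigenvector⇒InTΔ GLh GLg λ′≉0 (proj₂ (inverse λ′ λ′≉0)) eigen)
      InTΔ⇒eigenvector
  where open EigenvectorOfKronecker K p q r
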